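{- Let $p$ be a prime with $p \equiv 7$ or $23 \pmod{40}$. Then there is no triple $(N,M,e) \in \mathbb{Z}^3$ with $M \neq 0$, $e \neq 0$ satisfying $N^2 = 2pM^4 + 10e^4$ together with $\gcd(N,e)=\gcd(M,e)=\gcd(2p,e)=\gcd(10,M)=\gcd(M,N)=1$. -}

module Defs where

-- Only the 2-adic part of the hypotheses matters. The gcd conditions force M and e to be odd, so M⁴ ≡ e⁴ ≡ 1
-- (mod 16), and p ≡ 7 (mod 8) then gives 2pM⁴ + 10e⁴ ≡ 2p + 10 ≡ 8
-- (mod 16). But 8 is not a square modulo 16.
module Submission where

open import Defs
open import Data.Nat using (ℕ; _%_)
open import Data.Nat.Primality using (Prime)
open import Data.Integer using (ℤ; +_; _+_; _*_; _^_)
open import Data.Integer.GCD using (gcd)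
open import Data.Product using (Σ; _×_)
open import Data.Sum using (_⊎_)
open import Relation.Binary.PropositionalEquality using (_≡_; _≢_)
open import Relation.Nullary using (¬_)

open import Data.Nat as ℕ using (zero; suc; _<_; _≟_; NonZero)
open import Data.Nat.Properties using (*-identityʳ; *-comm; allUpTo?)
open import Data.Nat.DivMod
  using (m%n<n; m%n%n≡m%n; %-distribˡ-+; %-distribˡ-*; [m+kn]%n≡m%n; m≡m%n+[m/n]*n; m∣n⇒o%n%m≡o%m)
open import Data.Nat.Divisibility using (_∣_; _∣?_; divides; ∣n∣m%n⇒∣m)
open import Data.Nat.Coprimality using (Coprime; gcd≡1⇒coprime)
open import Data.Nat.Tactic.RingSolver using (solve-∀)
open import Data.Integer using (-[1+_]; ∣_∣)
open import Data.Integer.Properties using (pos-+; pos-*; +-injective)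
open import Data.Product using (_,_)
open import Data.Sum using (inj₁; inj₂)
open import Data.Unit using (tt)
open import Function using (_∘_)
open import Relation.Nullary using (¬?)
open import Relation.Nullary.Decidable using (toWitness; _→-dec_)
open import Relation.Binary.PropositionalEquality using (refl; sym; trans; cong; cong₂; subst; module ≡-Reasoning)
open ≡-Reasoning

%-distribˡ-^ : ∀ m k d .{{_ : NonZero d}} → (m ℕ.^ k) % d ≡ ((m % d) ℕ.^ k) % d
%-distribˡ-^ m zero    d = refl
%-distribˡ-^ m (suc k) d = begin
  (m ℕ.* m ℕ.^ k) % d                           ≡⟨ %-distribˡ-* m (m ℕ.^ k) d ⟩
  (m % d ℕ.* ((m ℕ.^ k) % d)) % d               ≡⟨ cong (λ t → (m % d ℕ.* t) % d) (%-distribˡ-^ m k d) ⟩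
  (m % d ℕ.* (((m % d) ℕ.^ k) % d)) % d         ≡⟨ cong (λ t → (t ℕ.* (((m % d) ℕ.^ k) % d)) % d) (sym (m%n%n≡m%n m d)) ⟩
  (m % d % d ℕ.* (((m % d) ℕ.^ k) % d)) % d     ≡⟨ sym (%-distribˡ-* (m % d) ((m % d) ℕ.^ k) d) ⟩
  (m % d ℕ.* (m % d) ℕ.^ k) % d                 ∎

m%d≡1⇒[k*m]%d≡k%d : ∀ k m d .{{_ : NonZero d}} → m % d ≡ 1 → (k ℕ.* m) % d ≡ k % d
m%d≡1⇒[k*m]%d≡k%d k m d m%d≡1 = begin
  (k ℕ.* m) % d            ≡⟨ %-distribˡ-* k m d ⟩
  (k % d ℕ.* (m % d)) % d  ≡⟨ cong (λ t → (k % d ℕ.* t) % d) m%d≡1 ⟩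
  (k % d ℕ.* 1) % d        ≡⟨ cong (_% d) (*-identityʳ (k % d)) ⟩
  k % d % d                ≡⟨ m%n%n≡m%n k d ⟩
  k % d                    ∎

n^2%16≢8 : ∀ n → (n ℕ.^ 2) % 16 ≢ 8
n^2%16≢8 n = subst (_≢ 8) (sym (%-distribˡ-^ n 2 16)) (residues (m%n<n n 16))
  where
  residues : ∀ {r} → r < 16 → (r ℕ.^ 2) % 16 ≢ 8
  residues = toWitness {a? = allUpTo? (λ r → ¬? ((r ℕ.^ 2) % 16 ≟ 8)) 16} tt

odd⇒n^4%16≡1 : ∀ n → ¬ 2 ∣ n → (n ℕ.^ 4) % 16 ≡ 1
odd⇒n^4%16≡1 n 2∤n = trans (%-distribˡ-^ n 4 16)
  (residues (m%n<n n 16) (2∤n ∘ ∣n∣m%n⇒∣m (divides 8 refl)))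
  where
  residues : ∀ {r} → r < 16 → ¬ 2 ∣ r → (r ℕ.^ 4) % 16 ≡ 1
  residues = toWitness {a? = allUpTo? (λ r → ¬? (2 ∣? r) →-dec ((r ℕ.^ 4) % 16 ≟ 1)) 16} tt

p%8≡7⇒[2p+10]%16≡8 : ∀ p → p % 8 ≡ 7 → (2 ℕ.* p ℕ.+ 10) % 16 ≡ 8
p%8≡7⇒[2p+10]%16≡8 p p%8≡7 = begin
  (2 ℕ.* p ℕ.+ 10) % 16                   ≡⟨ cong (λ t → (2 ℕ.* t ℕ.+ 10) % 16) p≡7+q*8 ⟩
  (2 ℕ.* (7 ℕ.+ q ℕ.* 8) ℕ.+ 10) % 16     ≡⟨ cong (_% 16) (2[7+q*8]+10≡24+q*16 q) ⟩
  (24 ℕ.+ q ℕ.* 16) % 16                  ≡⟨ [m+kn]%n≡m%n 24 q 16 ⟩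
  8                                       ∎
  where
  q = p ℕ./ 8
  p≡7+q*8 : p ≡ 7 ℕ.+ q ℕ.* 8
  p≡7+q*8 = trans (m≡m%n+[m/n]*n p 8) (cong (ℕ._+ q ℕ.* 8) p%8≡7)
  2[7+q*8]+10≡24+q*16 : ∀ q → 2 ℕ.* (7 ℕ.+ q ℕ.* 8) ℕ.+ 10 ≡ 24 ℕ.+ q ℕ.* 16
  2[7+q*8]+10≡24+q*16 = solve-∀

2pM⁴+10e⁴%16≡8 : ∀ p M e → p % 8 ≡ 7 → ¬ 2 ∣ M → ¬ 2 ∣ e →
  (2 ℕ.* p ℕ.* M ℕ.^ 4 ℕ.+ 10 ℕ.* e ℕ.^ 4) % 16 ≡ 8
2pM⁴+10e⁴%16≡8 p M e p%8≡7 2∤M 2∤e = begin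
  (2 ℕ.* p ℕ.* M ℕ.^ 4 ℕ.+ 10 ℕ.* e ℕ.^ 4) % 16
    ≡⟨ %-distribˡ-+ (2 ℕ.* p ℕ.* M ℕ.^ 4) (10 ℕ.* e ℕ.^ 4) 16 ⟩
  ((2 ℕ.* p ℕ.* M ℕ.^ 4) % 16 ℕ.+ (10 ℕ.* e ℕ.^ 4) % 16) % 16
    ≡⟨ cong₂ (λ a b → (a ℕ.+ b) % 16)
         (m%d≡1⇒[k*m]%d≡k%d (2 ℕ.* p) (M ℕ.^ 4) 16 (odd⇒n^4%16≡1 M 2∤M))
         (m%d≡1⇒[k*m]%d≡k%d 10 (e ℕ.^ 4) 16 (odd⇒n^4%16≡1 e 2∤e)) ⟩
  ((2 ℕ.* p) % 16 ℕ.+ 10 % 16) % 16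
    ≡⟨ sym (%-distribˡ-+ (2 ℕ.* p) 10 16) ⟩
  (2 ℕ.* p ℕ.+ 10) % 16
    ≡⟨ p%8≡7⇒[2p+10]%16≡8 p p%8≡7 ⟩
  8 ∎

n^2≢2pM⁴+10e⁴ : ∀ n p M e → p % 8 ≡ 7 → ¬ 2 ∣ M → ¬ 2 ∣ e →
  n ℕ.^ 2 ≢ 2 ℕ.* p ℕ.* M ℕ.^ 4 ℕ.+ 10 ℕ.* e ℕ.^ 4
n^2≢2pM⁴+10e⁴ n p M e p%8≡7 2∤M 2∤e eq =
  n^2%16≢8 n (trans (cong (_% 16) eq) (2pM⁴+10e⁴%16≡8 p M e p%8≡7 2∤M 2∤e))

coprime-to-even⇒odd : ∀ {k m} → Coprime k m → 2 ∣ k → ¬ 2 ∣ m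
coprime-to-even⇒odd coprime 2∣k 2∣m with coprime (2∣k , 2∣m)
... | ()

i^2≡+∣i∣^2 : ∀ i → i ^ 2 ≡ + (∣ i ∣ ℕ.^ 2)
i^2≡+∣i∣^2 (+ zero)  = refl
i^2≡+∣i∣^2 (+ suc n) = refl
i^2≡+∣i∣^2 -[1+ n ]  = refl

i^4≡+∣i∣^4 : ∀ i → i ^ 4 ≡ + (∣ i ∣ ℕ.^ 4)
i^4≡+∣i∣^4 (+ zero)  = refl
i^4≡+∣i∣^4 (+ suc n) = refl
i^4≡+∣i∣^4 -[1+ n ]  = refl

∣-∣-preserves-equation : ∀ p N M e → N ^ 2 ≡ + 2 * + p * M ^ 4 + + 10 * e ^ 4 →
  ∣ N ∣ ℕ.^ 2 ≡ 2 ℕ.* p ℕ.* ∣ M ∣ ℕ.^ 4 ℕ.+ 10 ℕ.* ∣ e ∣ ℕ.^ 4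
∣-∣-preserves-equation p N M e eq = +-injective (begin
  + (∣ N ∣ ℕ.^ 2)                                      ≡⟨ sym (i^2≡+∣i∣^2 N) ⟩
  N ^ 2                                               ≡⟨ eq ⟩
  + 2 * + p * M ^ 4 + + 10 * e ^ 4                    ≡⟨ cong₂ (λ a b → + 2 * + p * a + + 10 * b) (i^4≡+∣i∣^4 M) (i^4≡+∣i∣^4 e) ⟩
  + 2 * + p * + A + + 10 * + B                        ≡⟨ cong (λ t → t * + A + + 10 * + B) (sym (pos-* 2 p)) ⟩
  + (2 ℕ.* p) * + A + + 10 * + B                      ≡⟨ cong₂ _+_ (sym (pos-* (2 ℕ.* p) A)) (sym (pos-* 10 B)) ⟩
  + (2 ℕ.* p ℕ.* A) + + (10 ℕ.* B)                    ≡⟨ sym (pos-+ (2 ℕ.* p ℕ.* A) (10 ℕ.* B)) ⟩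
  + (2 ℕ.* p ℕ.* A ℕ.+ 10 ℕ.* B)                      ∎)
  where
  A B : ℕ
  A = ∣ M ∣ ℕ.^ 4
  B = ∣ e ∣ ℕ.^ 4

p%40≡7∨23⇒p%8≡7 : ∀ p → (p % 40 ≡ 7 ⊎ p % 40 ≡ 23) → p % 8 ≡ 7
p%40≡7∨23⇒p%8≡7 p p%40 = trans (sym (m∣n⇒o%n%m≡o%m 8 40 p (divides 5 refl))) (residue p%40)
  where
  residue : (p % 40 ≡ 7 ⊎ p % 40 ≡ 23) → p % 40 % 8 ≡ 7
  residue (inj₁ eq) = cong (_% 8) eq
  residue (inj₂ eq) = cong (_% 8) eq

lemma3p7 : (p : ℕ) → Prime p → (p % 40 ≡ 7 ⊎ p % 40 ≡ 23) →
    ¬ (Σ ℤ λ N → Σ ℤ λ M → Σ ℤ λ e →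
        M ≢ + 0 × e ≢ + 0 ×
        N ^ 2 ≡ + 2 * + p * M ^ 4 + + 10 * e ^ 4 ×
        gcd N e ≡ + 1 × gcd M e ≡ + 1 × gcd (+ 2 * + p) e ≡ + 1 ×
        gcd (+ 10) M ≡ + 1 × gcd M N ≡ + 1)
lemma3p7 p _ p%40 (N , M , e , _ , _ , eq , _ , _ , gcd[2p,e]≡1 , gcd[10,M]≡1 , _) =
  n^2≢2pM⁴+10e⁴ (∣ N ∣) p (∣ M ∣) (∣ e ∣) (p%40≡7∨23⇒p%8≡7 p p%40) 2∤M 2∤e (∣-∣-preserves-equation p N M e eq)
  where
  2∤M : ¬ 2 ∣ ∣ M ∣
  2∤M = coprime-to-even⇒odd (gcd≡1⇒coprime (cong ∣_∣ gcd[10,M]≡1)) (divides 5 refl)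
  2∤e : ¬ 2 ∣ ∣ e ∣
  2∤e = coprime-to-even⇒odd (gcd≡1⇒coprime (cong ∣_∣ (trans (cong (λ t → gcd t e) (pos-* 2 p)) gcd[2p,e]≡1)))
                            (divides p (*-comm 2 p))
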